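{- Let $\mathbb{K}$ be a field and $n \geq 2$. For any non-singular $n \times n$ matrix $\mathbf{X}$ over $\mathbb{K}$ all of whose entries are non-zero, and any fixed row (respectively column) of $\mathbf{X}$, at most $n-2$ of the $n$ minors $\det \mathbf{X}_{i,j}$ appearing in the Laplace (cofactor) expansion of $\det \mathbf{X}$ along that row (respectively column) are zero.
   Context: $\mathbf{X}_{i,j}$ denotes the $(n-1)\times(n-1)$ submatrix of $\mathbf{X}$ obtained by deleting the $i$-th row and $j$-th column; the Laplace expansion along row $i$ is $\det \mathbf{X} = \sum_{j=1}^n (-1)^{i+j} x_{i,j} \det \mathbf{X}_{i,j}$, and analogously along a column. -}

module Defs where

open import Level using (_⊔_)
open import Data.Nat using (ℕ; zero; suc)
open import Data.Fin using (Fin; zero; suc; punchIn)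
open import Data.Product using (Σ; _×_)
open import Relation.Nullary using (¬_)
open import Algebra.Bundles using (CommutativeRing)
import Algebra.Definitions.RawMonoid as RawMonoidDefs

record Field (c ℓ : Level.Level) : Set (Level.suc (c ⊔ ℓ)) where
  field
    commutativeRing : CommutativeRing c ℓ
  open CommutativeRing commutativeRing public
  field
    0≉1     : ¬ (0# ≈ 1#)
    inverse : ∀ x → ¬ (x ≈ 0#) → Σ Carrier (λ y → x * y ≈ 1#)

module Matrices {c ℓ} (R : CommutativeRing c ℓ) where
  open CommutativeRing R hiding (zero)
  open RawMonoidDefs +-rawMonoid using (sum)

  Matrix : ℕ → Set c
  Matrix n = Fin n → Fin n → Carrier

  minor : ∀ {n} → Fin (suc n) → Fin (suc n) → Matrix (suc n) → Matrix n
  minor i j X a b = X (punchIn i a) (punchIn j b)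

  sign : ∀ {n} → Fin n → Carrier
  sign zero    = 1#
  sign (suc j) = - sign j

  det : ∀ {n} → Matrix n → Carrier
  det {zero}  X = 1#
  det {suc n} X = sum (λ j → sign j * (X zero j * det (minor zero j X)))

-- Fix a row i and suppose every minor det X_{i,j} with j ≠ j₀ vanishes. Expanding another
-- row r against the cofactors of row i computes, up to sign, the determinant of a matrix
-- with a repeated row, so 0 = ±X_{r,j₀}·det X_{i,j₀}; as K is a field and X_{r,j₀} ≠ 0, the
-- minor det X_{i,j₀} vanishes too, and the Laplace expansion along row i gives det X = 0.
-- Columns follow by transposition; n − 1 distinct indices among n leave at most one out.
module Submission where

open import Defs
open import Data.Nat using (ℕ; zero; suc; _<_)
open import Data.Nat.Properties using (n<1+n)
open import Data.Fin using (Fin; zero; suc; punchIn; punchOut)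
open import Data.Fin.Properties
  using (_≟_; any?; all?; ¬∀⟶∃¬; <⇒notInjective; punchOut-injective; punchInᵢ≢i)
open import Data.Product using (∃; _×_; _,_; proj₁; proj₂)
open import Data.Vec.Functional using (Vector; _∷_; removeAt; transpose)
open import Data.Empty using (⊥-elim)
open import Function using (_∘_; flip)
open import Function.Definitions using (Injective)
open import Relation.Nullary using (¬_; yes; no; contradiction)
open import Relation.Unary using (Pred)
open import Relation.Binary.PropositionalEquality as ≡ using (_≡_; _≢_)
open import Algebra.Bundles using (CommutativeRing)
open import Data.Maybe using (nothing)
open import Tactic.RingSolver.Core.AlmostCommutativeRing using (fromCommutativeRing)

misses-some : ∀ {n m} → n < m → (f : Fin n → Fin m) → ∃ λ j → ∀ k → f k ≢ j
misses-some {n} {m} n<m f with all? (λ j → any? (λ k → f k ≟ j))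
... | yes surjective = ⊥-elim (<⇒notInjective n<m preimage-injective)
  where
  preimage : Fin m → Fin n
  preimage j = proj₁ (surjective j)

  preimage-injective : Injective _≡_ _≡_ preimage
  preimage-injective {j} {j′} eq =
    ≡.trans (≡.sym (proj₂ (surjective j))) (≡.trans (≡.cong f eq) (proj₂ (surjective j′)))
... | no ¬surjective with j , ¬hit ← ¬∀⟶∃¬ m _ (λ j → any? (λ k → f k ≟ j)) ¬surjective =
  j , λ k fk≡j → ¬hit (k , fk≡j)

module _ {n m : ℕ} {f : Fin n → Fin (suc m)} {j : Fin (suc m)} (misses-j : ∀ k → f k ≢ j) where

  avoiding : Fin n → Fin m
  avoiding k = punchOut (misses-j k ∘ ≡.sym)

  avoiding-injective : Injective _≡_ _≡_ f → Injective _≡_ _≡_ avoiding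
  avoiding-injective f-injective =
    f-injective ∘ punchOut-injective (misses-j _ ∘ ≡.sym) (misses-j _ ∘ ≡.sym)

  avoiding-misses : ∀ {j′} (j≢j′ : j ≢ j′) → (∀ k → f k ≢ j′) → ∀ k → avoiding k ≢ punchOut j≢j′
  avoiding-misses j≢j′ misses-j′ k eq = misses-j′ k (punchOut-injective _ j≢j′ eq)

injective-misses-unique : ∀ {n} {f : Fin n → Fin (suc n)} → Injective _≡_ _≡_ f →
                          ∀ {j j′} → (∀ k → f k ≢ j) → (∀ k → f k ≢ j′) → j ≡ j′
injective-misses-unique {zero} _ {zero} {zero} _ _ = ≡.refl
injective-misses-unique {suc n} f-injective {j} {j′} misses-j misses-j′ with j ≟ j′
... | yes j≡j′ = j≡j′
... | no  j≢j′ =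
  ⊥-elim (<⇒notInjective (n<1+n n)
    (avoiding-injective (avoiding-misses misses-j j≢j′ misses-j′)
                        (avoiding-injective misses-j f-injective)))

holds-on-image⇒holds-off-one : ∀ {n p} {P : Pred (Fin (suc n)) p} {f : Fin n → Fin (suc n)} →
                               Injective _≡_ _≡_ f → (∀ k → P (f k)) →
                               ∃ λ j₀ → ∀ j → j ≢ j₀ → P j
holds-on-image⇒holds-off-one {n} {P = P} {f} f-injective P∘f
  with j₀ , misses-j₀ ← misses-some (n<1+n n) f = j₀ , holds
  where
  holds : ∀ j → j ≢ j₀ → P j
  holds j j≢j₀ with any? (λ k → f k ≟ j)
  ... | yes (k , fk≡j) = ≡.subst P fk≡j (P∘f k)
  ... | no ¬hit = contradiction
    (injective-misses-unique f-injective (λ k fk≡j → ¬hit (k , fk≡j)) misses-j₀) j≢j₀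

swap₀₁ : ∀ {n} → Fin (suc (suc n)) → Fin (suc (suc n))
swap₀₁ zero          = suc zero
swap₀₁ (suc zero)    = zero
swap₀₁ (suc (suc i)) = suc (suc i)

module Determinant {c ℓ} (R : CommutativeRing c ℓ) where
  open CommutativeRing R hiding (zero)
  open Matrices R
  open import Algebra.Properties.Semiring.Sum semiring
    using (sum; sum-syntax; sum-cong-≋; sum-remove; sum-replicate-zero; ∑-comm; *-distribˡ-sum)
  open import Algebra.Properties.Ring ring
    using (-‿involutive; -‿distribˡ-*; -‿distribʳ-*; -0#≈0#; -‿+-comm)
  open import Algebra.Properties.CommutativeSemigroup +-commutativeSemigroup
    using () renaming (x∙yz≈y∙xz to x+yz≈y+xz)
  open import Algebra.Properties.CommutativeSemigroup *-commutativeSemigroup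
    using () renaming (x∙yz≈y∙xz to x*yz≈y*xz)
  open import Tactic.RingSolver.NonReflective (fromCommutativeRing R (λ _ → nothing))
  open import Relation.Binary.Reasoning.Setoid setoid

  sum-zero : ∀ {n} {g : Vector Carrier n} → (∀ j → g j ≈ 0#) → sum g ≈ 0#
  sum-zero {n} g≈0 = trans (sum-cong-≋ g≈0) (sum-replicate-zero n)

  sum-single : ∀ {n} (g : Vector Carrier (suc n)) j₀ → (∀ j → j ≢ j₀ → g j ≈ 0#) → sum g ≈ g j₀
  sum-single g j₀ g≈0 =
    trans (sum-remove g) (trans (+-congˡ (sum-zero (λ k → g≈0 _ (punchInᵢ≢i j₀ k))))
                                (+-identityʳ _))

  sum-neg : ∀ {n} (g : Vector Carrier n) → sum (λ j → - g j) ≈ - sum g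
  sum-neg {zero}  g = sym -0#≈0#
  sum-neg {suc n} g = trans (+-congˡ (sum-neg (g ∘ suc))) (-‿+-comm _ _)

  sum-swap₀₁ : ∀ {n} (g : Vector Carrier (suc (suc n))) → sum (g ∘ swap₀₁) ≈ sum g
  sum-swap₀₁ g = x+yz≈y+xz _ _ _

  *-zeroʳ₂ : ∀ x y → x * (y * 0#) ≈ 0#
  *-zeroʳ₂ x y = trans (*-congˡ (zeroʳ y)) (zeroʳ x)

  *-congˡ² : ∀ s x {d d′} → d ≈ d′ → s * (x * d) ≈ s * (x * d′)
  *-congˡ² s x d≈d′ = *-congˡ (*-congˡ d≈d′)

  det-cong : ∀ {n} {X Y : Matrix n} → (∀ a b → X a b ≈ Y a b) → det X ≈ det Y
  det-cong {zero}  X≈Y = refl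
  det-cong {suc n} X≈Y = sum-cong-≋ λ j →
    *-cong (refl {sign j})
           (*-cong (X≈Y zero j) (det-cong λ a b → X≈Y (punchIn zero a) (punchIn j b)))

  col₀Term : ∀ {n} → Matrix (suc n) → Fin (suc n) → Carrier
  col₀Term X i = sign i * (X i zero * det (minor i zero X))

  det-expand-col₀ : ∀ {n} (X : Matrix (suc n)) → det X ≈ sum (col₀Term X)
  det-expand-col₀ {zero}  X = refl
  det-expand-col₀ {suc n} X = +-congˡ (begin
      ∑[ j < suc n ] (sign (suc j) * (row₀ j * det (minor zero (suc j) X)))
    ≈⟨ sum-cong-≋ (λ j → *-congˡ² (sign (suc j)) (row₀ j)
                           (det-expand-col₀ (minor zero (suc j) X))) ⟩
      ∑[ j < suc n ] (sign (suc j) * (row₀ j * ∑[ i < suc n ] (sign i * (col₀ i * d i j))))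
    ≈⟨ sum-cong-≋ (λ j → *-*-distribˡ-sum (sign (suc j)) (row₀ j)
                           (λ i → sign i * (col₀ i * d i j))) ⟩
      ∑[ j < suc n ] ∑[ i < suc n ] (sign (suc j) * (row₀ j * (sign i * (col₀ i * d i j))))
    ≈⟨ ∑-comm (λ j i → sign (suc j) * (row₀ j * (sign i * (col₀ i * d i j)))) ⟩
      ∑[ i < suc n ] ∑[ j < suc n ] (sign (suc j) * (row₀ j * (sign i * (col₀ i * d i j))))
    ≈⟨ sum-cong-≋ (λ i → sum-cong-≋ (λ j → exchange (sign j) (row₀ j) (sign i) (col₀ i) (d i j))) ⟩
      ∑[ i < suc n ] ∑[ j < suc n ] (sign (suc i) * (col₀ i * (sign j * (row₀ j * d i j))))
    ≈⟨ sum-cong-≋ (λ i → sym (*-*-distribˡ-sum (sign (suc i)) (col₀ i)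
                                (λ j → sign j * (row₀ j * d i j)))) ⟩
      ∑[ i < suc n ] col₀Term X (suc i)
    ∎)
    where
    row₀ col₀ : Fin (suc n) → Carrier
    row₀ j = X zero (suc j)
    col₀ i = X (suc i) zero

    d : Fin (suc n) → Fin (suc n) → Carrier
    d i j = det (minor zero j (minor (suc i) zero X))

    *-*-distribˡ-sum : ∀ x y (g : Vector Carrier (suc n)) →
                       x * (y * sum g) ≈ ∑[ j < suc n ] (x * (y * g j))
    *-*-distribˡ-sum x y g = trans (*-congˡ (*-distribˡ-sum y g)) (*-distribˡ-sum x (λ j → y * g j))

    exchange : ∀ s x t y d → (- s) * (x * (t * (y * d))) ≈ (- t) * (y * (s * (x * d)))
    exchange = solve 5
      (λ s x t y d → (⊝ s) ⊗ (x ⊗ (t ⊗ (y ⊗ d))) ⊜ (⊝ t) ⊗ (y ⊗ (s ⊗ (x ⊗ d)))) refl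

  det-transpose : ∀ {n} (X : Matrix n) → det (transpose X) ≈ det X
  det-transpose {zero}  X = refl
  det-transpose {suc n} X = trans
    (sum-cong-≋ λ i → *-congˡ² (sign i) (X i zero) (det-transpose (minor i zero X)))
    (sym (det-expand-col₀ X))

  mutual
    det-swap₀₁ : ∀ {n} (X : Matrix (suc (suc n))) → det (X ∘ swap₀₁) ≈ - det X
    det-swap₀₁ X = begin
      det (X ∘ swap₀₁)                      ≈⟨ det-expand-col₀ (X ∘ swap₀₁) ⟩
      sum (col₀Term (X ∘ swap₀₁))           ≈⟨ sum-cong-≋ (col₀Term-swap₀₁ X) ⟩
      sum (λ i → - col₀Term X (swap₀₁ i))   ≈⟨ sum-swap₀₁ (λ i → - col₀Term X i) ⟩
      sum (λ i → - col₀Term X i)            ≈⟨ sum-neg (col₀Term X) ⟩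
      - sum (col₀Term X)                    ≈⟨ -‿cong (det-expand-col₀ X) ⟨
      - det X                               ∎

    col₀Term-swap₀₁ : ∀ {n} (X : Matrix (suc (suc n))) i →
                      col₀Term (X ∘ swap₀₁) i ≈ - col₀Term X (swap₀₁ i)
    col₀Term-swap₀₁ X zero = begin
      1# * (X (suc zero) zero * det (minor zero zero (X ∘ swap₀₁)))
        ≈⟨ *-congˡ² 1# (X (suc zero) zero) (det-cong rows) ⟩
      1# * term          ≈⟨ -‿involutive (1# * term) ⟨
      - - (1# * term)    ≈⟨ -‿cong (-‿distribˡ-* 1# term) ⟩
      - (- 1# * term)    ∎
      where
      term : Carrier
      term = X (suc zero) zero * det (minor (suc zero) zero X)

      rows : ∀ a b → minor zero zero (X ∘ swap₀₁) a b ≈ minor (suc zero) zero X a b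
      rows zero    b = refl
      rows (suc a) b = refl
    col₀Term-swap₀₁ X (suc zero) = trans
      (*-congˡ² (- 1#) (X zero zero) (det-cong rows))
      (sym (-‿distribˡ-* 1# (X zero zero * det (minor zero zero X))))
      where
      rows : ∀ a b → minor (suc zero) zero (X ∘ swap₀₁) a b ≈ minor zero zero X a b
      rows zero    b = refl
      rows (suc a) b = refl
    col₀Term-swap₀₁ {suc n} X (suc (suc i)) = begin
      sign (suc (suc i)) * (X (suc (suc i)) zero * det (minor (suc (suc i)) zero (X ∘ swap₀₁)))
        ≈⟨ *-congˡ (*-congˡ (trans (det-cong rows) (det-swap₀₁ (minor (suc (suc i)) zero X)))) ⟩
      sign (suc (suc i)) * (X (suc (suc i)) zero * - det (minor (suc (suc i)) zero X))
        ≈⟨ trans (-‿distribʳ-* _ _) (*-congˡ (-‿distribʳ-* _ _)) ⟨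
      - col₀Term X (suc (suc i)) ∎
      where
      rows : ∀ a b → minor (suc (suc i)) zero (X ∘ swap₀₁) a b
                   ≈ (minor (suc (suc i)) zero X ∘ swap₀₁) a b
      rows zero          b = refl
      rows (suc zero)    b = refl
      rows (suc (suc a)) b = refl

  mutual
    det-equalRows₀₁ : ∀ {n} (X : Matrix (suc (suc n))) →
                      (∀ b → X zero b ≈ X (suc zero) b) → det X ≈ 0#
    det-equalRows₀₁ {n} X row₀≈row₁ = begin
      det X                                               ≈⟨ det-expand-col₀ X ⟩
      col₀Term X zero + (col₀Term X (suc zero) + rest)    ≈⟨ +-congˡ (+-cong term₁ rest≈0) ⟩
      col₀Term X zero + (- col₀Term X zero + 0#)          ≈⟨ +-congˡ (+-identityʳ _) ⟩
      col₀Term X zero + - col₀Term X zero                 ≈⟨ -‿inverseʳ _ ⟩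
      0#                                                  ∎
      where
      rest : Carrier
      rest = ∑[ i < n ] col₀Term X (suc (suc i))

      rest≈0 : rest ≈ 0#
      rest≈0 = sum-zero (col₀Term₊₂-equalRows₀₁ X row₀≈row₁)

      term₁ : col₀Term X (suc zero) ≈ - col₀Term X zero
      term₁ = trans (*-congˡ (*-cong (sym (row₀≈row₁ zero)) (det-cong rows)))
                    (sym (-‿distribˡ-* 1# (X zero zero * det (minor zero zero X))))
        where
        rows : ∀ a b → minor (suc zero) zero X a b ≈ minor zero zero X a b
        rows zero    b = row₀≈row₁ (suc b)
        rows (suc a) b = refl

    col₀Term₊₂-equalRows₀₁ : ∀ {n} (X : Matrix (suc (suc n))) →
                             (∀ b → X zero b ≈ X (suc zero) b) →
                             ∀ i → col₀Term X (suc (suc i)) ≈ 0#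
    col₀Term₊₂-equalRows₀₁ {suc n} X row₀≈row₁ i = trans
      (*-congˡ² _ _ (det-equalRows₀₁ (minor (suc (suc i)) zero X) (row₀≈row₁ ∘ suc)))
      (*-zeroʳ₂ _ _)

  -- The defining first-row expansion of X i ∷ removeAt X i is the Laplace expansion of X
  -- along row i: its minors along the first row are exactly the minors X_{i,j}.
  det-moveRowToTop : ∀ {n} (i : Fin (suc n)) (X : Matrix (suc n)) →
                     det (X i ∷ removeAt X i) ≈ sign i * det X
  det-moveRowToTop zero X = trans (det-cong rows) (sym (*-identityˡ _))
    where
    rows : ∀ a b → (X zero ∷ removeAt X zero) a b ≈ X a b
    rows zero    b = refl
    rows (suc a) b = refl
  det-moveRowToTop {suc n} (suc i) X = begin
    det (X (suc i) ∷ removeAt X (suc i))  ≈⟨ det-cong rows ⟩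
    det (Y ∘ swap₀₁)                      ≈⟨ det-swap₀₁ Y ⟩
    - det Y                               ≈⟨ -‿cong det-Y ⟩
    - (sign i * det X)                    ≈⟨ -‿distribˡ-* _ _ ⟩
    sign (suc i) * det X                  ∎
    where
    -- row 0 of X on top of (X ∘ suc) with its row i moved up; swapping rows 0 and 1 of Y
    -- moves row suc i of X to the top, and the first-row minors of Y are handled by induction.
    Y : Matrix (suc (suc n))
    Y = X zero ∷ (X (suc i) ∷ removeAt (X ∘ suc) i)

    rows : ∀ a b → (X (suc i) ∷ removeAt X (suc i)) a b ≈ (Y ∘ swap₀₁) a b
    rows zero          b = refl
    rows (suc zero)    b = refl
    rows (suc (suc a)) b = refl

    minor-rows : ∀ j a b → minor zero j Y a b
                         ≈ (minor zero j X i ∷ removeAt (minor zero j X) i) a b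
    minor-rows j zero    b = refl
    minor-rows j (suc a) b = refl

    det-Y : det Y ≈ sign i * det X
    det-Y = begin
      ∑[ j < suc (suc n) ] (sign j * (X zero j * det (minor zero j Y)))
        ≈⟨ sum-cong-≋ (λ j → *-congˡ² (sign j) (X zero j)
             (trans (det-cong (minor-rows j)) (det-moveRowToTop i (minor zero j X)))) ⟩
      ∑[ j < suc (suc n) ] (sign j * (X zero j * (sign i * det (minor zero j X))))
        ≈⟨ sum-cong-≋ (λ j → trans (*-congˡ (x*yz≈y*xz (X zero j) (sign i) (det (minor zero j X))))
                                   (x*yz≈y*xz (sign j) (sign i) _)) ⟩
      ∑[ j < suc (suc n) ] (sign i * (sign j * (X zero j * det (minor zero j X))))
        ≈⟨ *-distribˡ-sum (sign i) (λ j → sign j * (X zero j * det (minor zero j X))) ⟨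
      sign i * det X ∎

  det-single-minor : ∀ {n} (X : Matrix (suc n)) i {j₀} →
                     (∀ j → j ≢ j₀ → det (minor i j X) ≈ 0#) →
                     ∀ r → det (r ∷ removeAt X i) ≈ sign j₀ * (r j₀ * det (minor i j₀ X))
  det-single-minor X i {j₀} vanish r =
    sum-single (λ j → sign j * (r j * det (minor i j X))) j₀ λ j j≢j₀ →
      trans (*-congˡ² (sign j) (r j) (vanish j j≢j₀)) (*-zeroʳ₂ _ _)

module FieldDeterminant {c ℓ} (K : Field c ℓ) where
  open Field K hiding (zero)
  open Matrices commutativeRing
  open Determinant commutativeRing
  open import Algebra.Properties.Ring ring using (-0#≈0#; -‿injective)
  open import Relation.Binary.Reasoning.Setoid setoid

  *-cancelˡ-0 : ∀ {x y} → x ≉ 0# → x * y ≈ 0# → y ≈ 0#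
  *-cancelˡ-0 {x} {y} x≉0 xy≈0 with x⁻¹ , xx⁻¹≈1 ← inverse x x≉0 = begin
    y                ≈⟨ *-identityˡ y ⟨
    1# * y           ≈⟨ *-congʳ (trans (*-comm x⁻¹ x) xx⁻¹≈1) ⟨
    (x⁻¹ * x) * y    ≈⟨ *-assoc x⁻¹ x y ⟩
    x⁻¹ * (x * y)    ≈⟨ *-congˡ xy≈0 ⟩
    x⁻¹ * 0#         ≈⟨ zeroʳ x⁻¹ ⟩
    0#               ∎

  sign-nonzero : ∀ {n} (j : Fin n) → sign j ≉ 0#
  sign-nonzero zero    1≈0  = 0≉1 (sym 1≈0)
  sign-nonzero (suc j) -s≈0 = sign-nonzero j (-‿injective (trans -s≈0 (sym -0#≈0#)))

  rowMinorsVanishExceptOne⇒det≈0 : ∀ {m} (X : Matrix (suc (suc m))) → (∀ a b → X a b ≉ 0#) →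
    ∀ i → (∃ λ j₀ → ∀ j → j ≢ j₀ → det (minor i j X) ≈ 0#) → det X ≈ 0#
  rowMinorsVanishExceptOne⇒det≈0 {m} X X≉0 i (j₀ , vanish) = *-cancelˡ-0 (sign-nonzero i) (begin
    sign i * det X                             ≈⟨ det-moveRowToTop i X ⟨
    det (X i ∷ removeAt X i)                   ≈⟨ det-single-minor X i vanish (X i) ⟩
    sign j₀ * (X i j₀ * det (minor i j₀ X))    ≈⟨ *-congˡ² (sign j₀) (X i j₀) minor≈0 ⟩
    sign j₀ * (X i j₀ * 0#)                    ≈⟨ *-zeroʳ₂ (sign j₀) (X i j₀) ⟩
    0#                                         ∎)
    where
    -- r ≠ i, and X r ∷ removeAt X i has X r as both its rows 0 and 1.
    r : Fin (suc (suc m))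
    r = punchIn i zero

    minor≈0 : det (minor i j₀ X) ≈ 0#
    minor≈0 = *-cancelˡ-0 (X≉0 r j₀) (*-cancelˡ-0 (sign-nonzero j₀) (begin
      sign j₀ * (X r j₀ * det (minor i j₀ X))   ≈⟨ det-single-minor X i vanish (X r) ⟨
      det (X r ∷ removeAt X i)                  ≈⟨ det-equalRows₀₁ (X r ∷ removeAt X i)
                                                                     (λ _ → refl) ⟩
      0#                                        ∎))

  colMinorsVanishExceptOne⇒det≈0 : ∀ {m} (X : Matrix (suc (suc m))) → (∀ a b → X a b ≉ 0#) →
    ∀ j → (∃ λ i₀ → ∀ i → i ≢ i₀ → det (minor i j X) ≈ 0#) → det X ≈ 0#
  colMinorsVanishExceptOne⇒det≈0 X X≉0 j (i₀ , vanish) = trans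
    (sym (det-transpose X))
    (rowMinorsVanishExceptOne⇒det≈0 (transpose X) (flip X≉0) j
      (i₀ , λ i i≢i₀ → trans (det-transpose (minor i j X)) (vanish i i≢i₀)))

propositionA1 : ∀ {c ℓ} (K : Field c ℓ) (m : ℕ) →
    let open Field K
        open Matrices commutativeRing
        n = suc (suc m)
    in (X : Matrix n) → ¬ (det X ≈ 0#) → (∀ i j → ¬ (X i j ≈ 0#)) →
       ((i : Fin n) (f : Fin (suc m) → Fin n) → Injective _≡_ _≡_ f →
          ¬ (∀ k → det (minor i (f k) X) ≈ 0#))
       ×
       ((j : Fin n) (f : Fin (suc m) → Fin n) → Injective _≡_ _≡_ f →
          ¬ (∀ k → det (minor (f k) j X) ≈ 0#))
propositionA1 K m X det≉0 X≉0 =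
    (λ i f f-injective vanish → det≉0 (rowMinorsVanishExceptOne⇒det≈0 X X≉0 i
      (holds-on-image⇒holds-off-one f-injective vanish)))
  , (λ j f f-injective vanish → det≉0 (colMinorsVanishExceptOne⇒det≈0 X X≉0 j
      (holds-on-image⇒holds-off-one f-injective vanish)))
  where open FieldDeterminant K
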